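{- Let $m\in\mathbb{N}$, let $q$ be a prime power and let $R=\mathrm{Mat}_m(\mathbb{F}_q)$. Let $k\in\mathbb{N}$ and let $f\colon R^k\to R$ be any function. Then there exists a restricted polynomial expression $p(x_1,\dots,x_k)$ over $R$ that induces the function $f$ on $R$.
   Context: For a ring $R$ with unity and a set of (noncommuting) variables $X$, a restricted monomial expression is a nonempty word over the alphabet $X\cup U(R)$, where $U(R)$ is the set of invertible elements of $R$ (so only invertible constants appear); a restricted polynomial expression is a finite, possibly empty, formal sum of restricted monomial expressions. It induces a function on $R$ by substituting elements of $R$ for the variables, multiplying the letters of each word in $R$ and adding the results (the empty sum gives $0$). -}

module Defs where

open import Level using (Level; _⊔_; suc)
open import Data.Nat using (ℕ; _^_; _≥_) renaming (suc to sucℕ)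
open import Data.Nat.Primality using (Prime)
open import Data.Fin using (Fin)
open import Data.Fin.Properties using (≡-setoid)
open import Data.Product using (Σ; ∃; _×_; _,_)
open import Data.List using (List; []; _∷_)
open import Data.List.NonEmpty using (List⁺; _∷_)
open import Data.Vec.Functional using (Vector)
open import Relation.Binary.PropositionalEquality using (_≡_)
open import Relation.Nullary using (¬_)
open import Algebra.Bundles using (CommutativeRing)
open import Algebra.Bundles.Raw using (RawRing)
open import Function.Bundles using (Bijection)

IsPrimePower : ℕ → Set
IsPrimePower q = Σ ℕ λ p → Σ ℕ λ n → Prime p × n ≥ 1 × q ≡ p ^ n

record Field (c ℓ : Level) : Set (suc (c ⊔ ℓ)) where
  field
    commutativeRing : CommutativeRing c ℓ
  open CommutativeRing commutativeRing public
  field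
    0≉1     : ¬ (0# ≈ 1#)
    inverse : ∀ x → ¬ (x ≈ 0#) → Σ Carrier λ y → (x * y) ≈ 1#

HasOrder : ∀ {c ℓ} → Field c ℓ → ℕ → Set (c ⊔ ℓ)
HasOrder F q = Bijection (Field.setoid F) (≡-setoid q)

module RingNotions {c ℓ} (R : RawRing c ℓ) where
  open RawRing R

  IsUnit : Carrier → Set (c ⊔ ℓ)
  IsUnit u = Σ Carrier λ v → (u * v) ≈ 1# × (v * u) ≈ 1#

  Unit : Set (c ⊔ ℓ)
  Unit = Σ Carrier IsUnit

  -- letters of the alphabet X ∪ U(R), with X = {x₁,…,x_k} = Fin k
  data Letter (k : ℕ) : Set (c ⊔ ℓ) where
    var   : Fin k → Letter k
    const : Unit → Letter k

  RMonomial : ℕ → Set (c ⊔ ℓ)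
  RMonomial k = List⁺ (Letter k)

  RPolynomial : ℕ → Set (c ⊔ ℓ)
  RPolynomial k = List (RMonomial k)

  evalLetter : ∀ {k} → Letter k → Vector Carrier k → Carrier
  evalLetter (var i)             xs = xs i
  evalLetter (const (u , _))     xs = u

  evalMonomial : ∀ {k} → RMonomial k → Vector Carrier k → Carrier
  evalMonomial (a ∷ as) xs = go a as
    where
    go : _ → List (Letter _) → Carrier
    go a []       = evalLetter a xs
    go a (b ∷ bs) = evalLetter a xs * go b bs

  evalPolynomial : ∀ {k} → RPolynomial k → Vector Carrier k → Carrier
  evalPolynomial []       xs = 0#
  evalPolynomial (t ∷ ts) xs = evalMonomial t xs + evalPolynomial ts xs

  Induces : ∀ {k} → RPolynomial k → (Vector Carrier k → Carrier) → Set (c ⊔ ℓ)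
  Induces p f = ∀ xs → evalPolynomial p xs ≈ f xs

  -- f is a function R^k → R (respects the setoid equality of R)
  Congruent : ∀ {k} → (Vector Carrier k → Carrier) → Set (c ⊔ ℓ)
  Congruent f = ∀ xs ys → (∀ i → xs i ≈ ys i) → f xs ≈ f ys

-- the m×m matrix ring Mat_m(K) over a commutative ring K (as raw ring operations;
-- only the operations are needed to state the notions above)
module MatrixRing {c ℓ} (K : CommutativeRing c ℓ) where
  open CommutativeRing K
  open import Data.Fin using () renaming (zero to fzero; suc to fsuc)
  open import Data.Nat using (zero; suc)
  open import Relation.Nullary using (yes; no)
  open import Data.Fin using (_≟_)

  Mat : ℕ → Set c
  Mat m = Fin m → Fin m → Carrier

  ∑ : ∀ n → (Fin n → Carrier) → Carrier
  ∑ zero     g = 0#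
  ∑ (suc n) g = g fzero + ∑ n (λ j → g (fsuc j))

  matRing : ℕ → RawRing c ℓ
  matRing m = record
    { Carrier = Mat m
    ; _≈_ = λ A B → ∀ i j → A i j ≈ B i j
    ; _+_ = λ A B i j → A i j + B i j
    ; _*_ = λ A B i j → ∑ m (λ l → A i l * B l j)
    ; -_  = λ A i j → - A i j
    ; 0#  = λ i j → 0#
    ; 1#  = λ i j → δ i j
    }
    where
    δ : Fin m → Fin m → Carrier
    δ i j with i ≟ j
    ... | yes _ = 1#
    ... | no  _ = 0#

-- Over a finite field every value c has a Lagrange indicator polynomial χ_c, so the scalar
-- matrix χ_c(t)·1 is induced as soon as t·1 is.  The matrix units E_ab with a ≠ b square to
-- zero, hence E_ab = (1 + E_ab) + (-1) is a sum of two units; then E_aa = E_ab E_ba (or 1 when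
-- m = 1), nonzero scalar matrices are units, and A = Σ A_ab E_ab shows that every constant is
-- induced.  An entry of a variable is recovered as the scalar matrix x_ab·1 = Σ_l E_la x E_bl.
-- Finally f is induced by induction on the list of scalar coordinates it depends on, using
-- f(x) = Σ_c χ_c(x_p)·f(x[p := c]).
module Submission where

open import Defs
open import Level using (Level; _⊔_)
open import Data.Nat using (ℕ; zero; suc)
open import Data.Fin using (Fin; _≟_) renaming (zero to fzero; suc to fsuc)
open import Data.Fin.Properties using (punchInᵢ≢i; all?; ¬∀⟶∃¬)
open import Data.Product using (Σ; _×_; _,_; proj₁; proj₂)
open import Data.Product.Properties using (≡-dec)
open import Data.List using (List; []; _∷_; _++_; map; allFin; cartesianProduct)
open import Data.List.NonEmpty using (_∷_; _⁺++⁺_)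
open import Data.List.Membership.Propositional using (_∈_)
open import Data.List.Membership.Propositional.Properties using (∈-allFin; ∈-cartesianProduct⁺)
import Data.List.Relation.Unary.Any as Any
open import Data.Vec.Functional using (Vector; removeAt)
open import Data.Empty using (⊥-elim)
open import Function using (_∘_)
open import Function.Bundles using (Bijection)
open import Relation.Nullary using (¬_; Dec; yes; no)
open import Relation.Binary.Definitions using (Decidable; DecidableEquality)
open import Relation.Binary.PropositionalEquality as ≡ using (_≡_; _≢_)
open import Algebra.Bundles using (CommutativeRing; Ring)
open import Algebra.Bundles.Raw using (RawRing)
open import Algebra.Structures using (IsRing)
import Algebra.Construct.Pointwise as Pointwise
import Algebra.Properties.CommutativeMonoid.Sum
import Algebra.Properties.CommutativeSemigroup
import Algebra.Properties.Group
import Algebra.Properties.Ring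
import Algebra.Properties.Semiring.Sum

module FiniteSums {c ℓ} (K : CommutativeRing c ℓ) where
  open CommutativeRing K
  open MatrixRing K using (∑)
  module Sum = Algebra.Properties.Semiring.Sum semiring
  open Sum using (sum; sum-cong-≋; sum-replicate-zero; sum-remove)
  open import Relation.Binary.Reasoning.Setoid setoid

  ∑≡sum : ∀ n (g : Fin n → Carrier) → ∑ n g ≡ sum g
  ∑≡sum zero    g = ≡.refl
  ∑≡sum (suc n) g = ≡.cong (g fzero +_) (∑≡sum n (g ∘ fsuc))

  ∑-cong : ∀ n {g h : Fin n → Carrier} → (∀ l → g l ≈ h l) → ∑ n g ≈ ∑ n h
  ∑-cong n {g} {h} g≈h rewrite ∑≡sum n g | ∑≡sum n h = sum-cong-≋ g≈h

  ∑-single : ∀ {n} {g : Fin n → Carrier} i → (∀ l → l ≢ i → g l ≈ 0#) → ∑ n g ≈ g i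
  ∑-single {suc n} {g} i g≈0 rewrite ∑≡sum (suc n) g = begin
    sum g                     ≈⟨ sum-remove g ⟩
    g i + sum (removeAt g i)  ≈⟨ +-congˡ rest≈0 ⟩
    g i + 0#                  ≈⟨ +-identityʳ (g i) ⟩
    g i                       ∎
    where
    rest≈0 : sum (removeAt g i) ≈ 0#
    rest≈0 = trans (sum-cong-≋ (λ j → g≈0 _ (punchInᵢ≢i i j))) (sum-replicate-zero n)

  ∑-distrib-+ : ∀ n (g h : Fin n → Carrier) → ∑ n (λ l → g l + h l) ≈ ∑ n g + ∑ n h
  ∑-distrib-+ n g h rewrite ∑≡sum n (λ l → g l + h l) | ∑≡sum n g | ∑≡sum n h =
    Sum.∑-distrib-+ g h

  *-distribˡ-∑ : ∀ n a (g : Fin n → Carrier) → a * ∑ n g ≈ ∑ n (λ l → a * g l)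
  *-distribˡ-∑ n a g rewrite ∑≡sum n g | ∑≡sum n (λ l → a * g l) = Sum.*-distribˡ-sum a g

  *-distribʳ-∑ : ∀ n a (g : Fin n → Carrier) → ∑ n g * a ≈ ∑ n (λ l → g l * a)
  *-distribʳ-∑ n a g rewrite ∑≡sum n g | ∑≡sum n (λ l → g l * a) = Sum.*-distribʳ-sum a g

  ∑-comm : ∀ n p (g : Fin n → Fin p → Carrier) →
           ∑ n (λ i → ∑ p (g i)) ≈ ∑ p (λ j → ∑ n (λ i → g i j))
  ∑-comm n p g = begin
    ∑ n (λ i → ∑ p (g i))            ≈⟨ ∑-cong n (λ i → reflexive (∑≡sum p (g i))) ⟩
    ∑ n (λ i → sum (g i))            ≡⟨ ∑≡sum n _ ⟩
    sum (λ i → sum (g i))            ≈⟨ Sum.∑-comm g ⟩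
    sum (λ j → sum (λ i → g i j))    ≡⟨ ∑≡sum p _ ⟨
    ∑ p (λ j → sum (λ i → g i j))    ≈⟨ ∑-cong p (λ j → reflexive (∑≡sum n _)) ⟨
    ∑ p (λ j → ∑ n (λ i → g i j))    ∎

module MatrixRingProperties {c ℓ} (K : CommutativeRing c ℓ) (m : ℕ) where
  open CommutativeRing K
  open MatrixRing K
  open FiniteSums K
  open RawRing (matRing m) public using () renaming
    (Carrier to Matrix; _≈_ to _≋_; _+_ to _⊕_; _*_ to _⊗_; -_ to ⊖_; 0# to 𝟘; 1# to 𝟙)
  open Algebra.Properties.CommutativeSemigroup *-commutativeSemigroup using (x∙yz≈y∙xz)
  open import Relation.Binary.Reasoning.Setoid setoid

  𝟙-diagonal : ∀ i → 𝟙 i i ≈ 1#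
  𝟙-diagonal i with i ≟ i
  ... | yes _   = refl
  ... | no i≢i = ⊥-elim (i≢i ≡.refl)

  𝟙-offDiagonal : ∀ {i j} → i ≢ j → 𝟙 i j ≈ 0#
  𝟙-offDiagonal {i} {j} i≢j with i ≟ j
  ... | yes i≡j = ⊥-elim (i≢j i≡j)
  ... | no _    = refl

  ∑-𝟙ˡ : ∀ u (g : Fin m → Carrier) → ∑ m (λ l → 𝟙 u l * g l) ≈ g u
  ∑-𝟙ˡ u g = begin
    ∑ m (λ l → 𝟙 u l * g l)  ≈⟨ ∑-single u off-diagonal≈0 ⟩
    𝟙 u u * g u              ≈⟨ *-congʳ (𝟙-diagonal u) ⟩
    1# * g u                 ≈⟨ *-identityˡ (g u) ⟩
    g u                      ∎
    where
    off-diagonal≈0 : ∀ l → l ≢ u → 𝟙 u l * g l ≈ 0#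
    off-diagonal≈0 l l≢u = trans (*-congʳ (𝟙-offDiagonal (l≢u ∘ ≡.sym))) (zeroˡ (g l))

  ∑-𝟙ʳ : ∀ w (g : Fin m → Carrier) → ∑ m (λ l → g l * 𝟙 l w) ≈ g w
  ∑-𝟙ʳ w g = begin
    ∑ m (λ l → g l * 𝟙 l w)  ≈⟨ ∑-single w off-diagonal≈0 ⟩
    g w * 𝟙 w w              ≈⟨ *-congˡ (𝟙-diagonal w) ⟩
    g w * 1#                 ≈⟨ *-identityʳ (g w) ⟩
    g w                      ∎
    where
    off-diagonal≈0 : ∀ l → l ≢ w → g l * 𝟙 l w ≈ 0#
    off-diagonal≈0 l l≢w = trans (*-congˡ (𝟙-offDiagonal l≢w)) (zeroʳ (g l))

  ⊗-assoc : ∀ A B C → ((A ⊗ B) ⊗ C) ≋ (A ⊗ (B ⊗ C))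
  ⊗-assoc A B C i j = begin
    ∑ m (λ s → ∑ m (λ l → A i l * B l s) * C s j)
      ≈⟨ ∑-cong m (λ s → *-distribʳ-∑ m (C s j) _) ⟩
    ∑ m (λ s → ∑ m (λ l → (A i l * B l s) * C s j))
      ≈⟨ ∑-comm m m _ ⟩
    ∑ m (λ l → ∑ m (λ s → (A i l * B l s) * C s j))
      ≈⟨ ∑-cong m (λ l → ∑-cong m (λ s → *-assoc _ _ _)) ⟩
    ∑ m (λ l → ∑ m (λ s → A i l * (B l s * C s j)))
      ≈⟨ ∑-cong m (λ l → *-distribˡ-∑ m (A i l) _) ⟨
    ∑ m (λ l → A i l * ∑ m (λ s → B l s * C s j)) ∎

  matRing-isRing : IsRing _≋_ _⊕_ _⊗_ ⊖_ 𝟘 𝟙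
  matRing-isRing = record
    { +-isAbelianGroup = Pointwise.isAbelianGroup (Fin m)
                           (Pointwise.isAbelianGroup (Fin m) +-isAbelianGroup)
    ; *-cong           = λ A≋B C≋D i j → ∑-cong m (λ l → *-cong (A≋B i l) (C≋D l j))
    ; *-assoc          = ⊗-assoc
    ; *-identity       = (λ A i j → ∑-𝟙ˡ i (λ l → A l j)) , (λ A i j → ∑-𝟙ʳ j (A i))
    ; distrib          = (λ A B C i j → trans (∑-cong m (λ l → distribˡ _ _ _))
                                              (∑-distrib-+ m _ _))
                       , (λ A B C i j → trans (∑-cong m (λ l → distribʳ _ _ _))
                                              (∑-distrib-+ m _ _))
    }

  matrixRing : Ring c ℓ
  matrixRing = record { isRing = matRing-isRing }

  open Algebra.Properties.Semiring.Sum (Ring.semiring matrixRing) public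
    using () renaming (sum to sumᴹ)
  open RingNotions (matRing m) using (IsUnit)

  scalar : Carrier → Matrix
  scalar a i j = a * 𝟙 i j

  matrixUnit : Fin m → Fin m → Matrix
  matrixUnit a b i j = 𝟙 i a * 𝟙 b j

  sumᴹ-entry : ∀ {n} (As : Fin n → Matrix) i j → sumᴹ As i j ≡ ∑ n (λ l → As l i j)
  sumᴹ-entry {zero}  As i j = ≡.refl
  sumᴹ-entry {suc n} As i j = ≡.cong (As fzero i j +_) (sumᴹ-entry (As ∘ fsuc) i j)

  scalar-⊗ : ∀ a A i j → (scalar a ⊗ A) i j ≈ a * A i j
  scalar-⊗ a A i j = begin
    ∑ m (λ l → (a * 𝟙 i l) * A l j)  ≈⟨ ∑-cong m (λ l → *-assoc _ _ _) ⟩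
    ∑ m (λ l → a * (𝟙 i l * A l j))  ≈⟨ *-distribˡ-∑ m a _ ⟨
    a * ∑ m (λ l → 𝟙 i l * A l j)    ≈⟨ *-congˡ (∑-𝟙ˡ i (λ l → A l j)) ⟩
    a * A i j                        ∎

  scalar-+ : ∀ a b → scalar (a + b) ≋ (scalar a ⊕ scalar b)
  scalar-+ a b i j = distribʳ _ _ _

  scalar-* : ∀ a b → scalar (a * b) ≋ (scalar a ⊗ scalar b)
  scalar-* a b i j = trans (*-assoc _ _ _) (sym (scalar-⊗ a (scalar b) i j))

  scalar-1# : scalar 1# ≋ 𝟙
  scalar-1# i j = *-identityˡ _

  scalar-isUnit : ∀ {a b} → a * b ≈ 1# → IsUnit (scalar a)
  scalar-isUnit {a} {b} ab≈1 =
    scalar b , inverseOf a b ab≈1 , inverseOf b a (trans (*-comm b a) ab≈1)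
    where
    inverseOf : ∀ a b → a * b ≈ 1# → (scalar a ⊗ scalar b) ≋ 𝟙
    inverseOf a b ab≈1 i j =
      trans (sym (scalar-* a b i j)) (trans (*-congʳ ab≈1) (scalar-1# i j))

  matrixUnit-⊗ˡ : ∀ a b A i j → (matrixUnit a b ⊗ A) i j ≈ 𝟙 i a * A b j
  matrixUnit-⊗ˡ a b A i j = begin
    ∑ m (λ l → (𝟙 i a * 𝟙 b l) * A l j)  ≈⟨ ∑-cong m (λ l → *-assoc _ _ _) ⟩
    ∑ m (λ l → 𝟙 i a * (𝟙 b l * A l j))  ≈⟨ *-distribˡ-∑ m (𝟙 i a) _ ⟨
    𝟙 i a * ∑ m (λ l → 𝟙 b l * A l j)    ≈⟨ *-congˡ (∑-𝟙ˡ b (λ l → A l j)) ⟩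
    𝟙 i a * A b j                        ∎

  matrixUnit-⊗ʳ : ∀ A a b i j → (A ⊗ matrixUnit a b) i j ≈ A i a * 𝟙 b j
  matrixUnit-⊗ʳ A a b i j = begin
    ∑ m (λ l → A i l * (𝟙 l a * 𝟙 b j))  ≈⟨ ∑-cong m (λ l → *-assoc _ _ _) ⟨
    ∑ m (λ l → (A i l * 𝟙 l a) * 𝟙 b j)  ≈⟨ *-distribʳ-∑ m (𝟙 b j) _ ⟨
    ∑ m (λ l → A i l * 𝟙 l a) * 𝟙 b j    ≈⟨ *-congʳ (∑-𝟙ʳ a (A i)) ⟩
    A i a * 𝟙 b j                        ∎

  matrixUnit-⊗-matrixUnit : ∀ a b d → (matrixUnit a b ⊗ matrixUnit b d) ≋ matrixUnit a d
  matrixUnit-⊗-matrixUnit a b d i j =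
    trans (matrixUnit-⊗ˡ a b (matrixUnit b d) i j)
          (*-congˡ (trans (*-congʳ (𝟙-diagonal b)) (*-identityˡ _)))

  matrixUnit-square-zero : ∀ {a b} → a ≢ b → (matrixUnit a b ⊗ matrixUnit a b) ≋ 𝟘
  matrixUnit-square-zero {a} {b} a≢b i j = begin
    (matrixUnit a b ⊗ matrixUnit a b) i j  ≈⟨ matrixUnit-⊗ˡ a b (matrixUnit a b) i j ⟩
    𝟙 i a * (𝟙 b a * 𝟙 b j)               ≈⟨ *-congˡ (*-congʳ (𝟙-offDiagonal (a≢b ∘ ≡.sym))) ⟩
    𝟙 i a * (0# * 𝟙 b j)                  ≈⟨ *-congˡ (zeroˡ _) ⟩
    𝟙 i a * 0#                            ≈⟨ zeroʳ _ ⟩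
    0#                                    ∎

  matrixUnit-only-index : ∀ {a} → (∀ i → i ≡ a) → matrixUnit a a ≋ 𝟙
  matrixUnit-only-index {a} only-a i j rewrite only-a i | only-a j =
    trans (*-congˡ (𝟙-diagonal a)) (*-identityʳ _)

  matrix-decomposition : ∀ A → sumᴹ (λ a → sumᴹ (λ b → scalar (A a b) ⊗ matrixUnit a b)) ≋ A
  matrix-decomposition A i j = begin
    sumᴹ (λ a → sumᴹ (λ b → scalar (A a b) ⊗ matrixUnit a b)) i j
      ≡⟨ sumᴹ-entry (λ a → sumᴹ (λ b → scalar (A a b) ⊗ matrixUnit a b)) i j ⟩
    ∑ m (λ a → sumᴹ (λ b → scalar (A a b) ⊗ matrixUnit a b) i j)
      ≈⟨ ∑-cong m (λ a → reflexive (sumᴹ-entry (λ b → scalar (A a b) ⊗ matrixUnit a b) i j)) ⟩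
    ∑ m (λ a → ∑ m (λ b → (scalar (A a b) ⊗ matrixUnit a b) i j))
      ≈⟨ ∑-cong m (λ a → ∑-cong m (λ b →
           trans (scalar-⊗ (A a b) (matrixUnit a b) i j) (x∙yz≈y∙xz _ _ _))) ⟩
    ∑ m (λ a → ∑ m (λ b → 𝟙 i a * (A a b * 𝟙 b j)))
      ≈⟨ ∑-cong m (λ a → *-distribˡ-∑ m (𝟙 i a) _) ⟨
    ∑ m (λ a → 𝟙 i a * ∑ m (λ b → A a b * 𝟙 b j))
      ≈⟨ ∑-cong m (λ a → *-congˡ (∑-𝟙ʳ j (A a))) ⟩
    ∑ m (λ a → 𝟙 i a * A a j)
      ≈⟨ ∑-𝟙ˡ i (λ a → A a j) ⟩
    A i j ∎

  entry-extraction : ∀ A a b → sumᴹ (λ l → (matrixUnit l a ⊗ A) ⊗ matrixUnit b l) ≋ scalar (A a b)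
  entry-extraction A a b i j = begin
    sumᴹ (λ l → (matrixUnit l a ⊗ A) ⊗ matrixUnit b l) i j
      ≡⟨ sumᴹ-entry (λ l → (matrixUnit l a ⊗ A) ⊗ matrixUnit b l) i j ⟩
    ∑ m (λ l → ((matrixUnit l a ⊗ A) ⊗ matrixUnit b l) i j)
      ≈⟨ ∑-cong m (λ l → trans (matrixUnit-⊗ʳ (matrixUnit l a ⊗ A) b l i j)
                                (*-congʳ (matrixUnit-⊗ˡ l a A i b))) ⟩
    ∑ m (λ l → (𝟙 i l * A a b) * 𝟙 l j)
      ≈⟨ ∑-cong m (λ l → *-assoc _ _ _) ⟩
    ∑ m (λ l → 𝟙 i l * (A a b * 𝟙 l j))
      ≈⟨ ∑-𝟙ˡ i (λ l → A a b * 𝟙 l j) ⟩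
    A a b * 𝟙 i j ∎

module InducedFunctions {c ℓ} (R : Ring c ℓ) (k : ℕ) where
  open Ring R
  open RingNotions rawRing
  open Algebra.Properties.Semiring.Sum semiring using (sum)
  open Algebra.Properties.Group +-group using (//-rightDividesˡ; //-rightDividesʳ; ε⁻¹≈ε)
  open Algebra.Properties.Ring R using (-1*x≈-x; -‿involutive; x[y-z]≈xy-xz; [y-z]x≈yx-zx)
  open import Relation.Binary.Reasoning.Setoid setoid

  Induced : (Vector Carrier k → Carrier) → Set (c ⊔ ℓ)
  Induced f = Σ (RPolynomial k) λ p → Induces p f

  induced-resp : ∀ {f g} → Induced f → (∀ xs → f xs ≈ g xs) → Induced g
  induced-resp (p , p≈f) f≈g = p , λ xs → trans (p≈f xs) (f≈g xs)

  induced-0# : Induced (λ _ → 0#)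
  induced-0# = [] , λ _ → refl

  induced-var : ∀ i → Induced (λ xs → xs i)
  induced-var i = (var i ∷ []) ∷ [] , λ _ → +-identityʳ _

  induced-unit : ∀ {u} → IsUnit u → Induced (λ _ → u)
  induced-unit u-unit = (const (_ , u-unit) ∷ []) ∷ [] , λ _ → +-identityʳ _

  induced-1# : Induced (λ _ → 1#)
  induced-1# = induced-unit (1# , *-identityˡ 1# , *-identityˡ 1#)

  evalPolynomial-++ : ∀ (ps qs : RPolynomial k) xs →
    evalPolynomial (ps ++ qs) xs ≈ evalPolynomial ps xs + evalPolynomial qs xs
  evalPolynomial-++ []       qs xs = sym (+-identityˡ _)
  evalPolynomial-++ (t ∷ ps) qs xs =
    trans (+-congˡ (evalPolynomial-++ ps qs xs)) (sym (+-assoc _ _ _))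

  induced-+ : ∀ {f g} → Induced f → Induced g → Induced (λ xs → f xs + g xs)
  induced-+ (p , p≈f) (q , q≈g) =
    p ++ q , λ xs → trans (evalPolynomial-++ p q xs) (+-cong (p≈f xs) (q≈g xs))

  evalMonomial-⁺++⁺ : ∀ (s t : RMonomial k) xs →
    evalMonomial (s ⁺++⁺ t) xs ≈ evalMonomial s xs * evalMonomial t xs
  evalMonomial-⁺++⁺ (a ∷ as) (b ∷ bs) xs = evalWord-++ a as
    where
    evalWord-++ : ∀ a as → evalMonomial (a ∷ (as ++ b ∷ bs)) xs ≈
                           evalMonomial (a ∷ as) xs * evalMonomial (b ∷ bs) xs
    evalWord-++ a []        = refl
    evalWord-++ a (a′ ∷ as) = trans (*-congˡ (evalWord-++ a′ as)) (sym (*-assoc _ _ _))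

  _·_ : RPolynomial k → RPolynomial k → RPolynomial k
  []       · qs = []
  (s ∷ ps) · qs = map (s ⁺++⁺_) qs ++ ps · qs

  evalPolynomial-map-⁺++⁺ : ∀ s (qs : RPolynomial k) xs →
    evalPolynomial (map (s ⁺++⁺_) qs) xs ≈ evalMonomial s xs * evalPolynomial qs xs
  evalPolynomial-map-⁺++⁺ s []       xs = sym (zeroʳ _)
  evalPolynomial-map-⁺++⁺ s (t ∷ qs) xs =
    trans (+-cong (evalMonomial-⁺++⁺ s t xs) (evalPolynomial-map-⁺++⁺ s qs xs))
          (sym (distribˡ _ _ _))

  evalPolynomial-· : ∀ (ps qs : RPolynomial k) xs →
    evalPolynomial (ps · qs) xs ≈ evalPolynomial ps xs * evalPolynomial qs xs
  evalPolynomial-· []       qs xs = sym (zeroˡ _)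
  evalPolynomial-· (s ∷ ps) qs xs = begin
    evalPolynomial (map (s ⁺++⁺_) qs ++ ps · qs) xs
      ≈⟨ evalPolynomial-++ (map (s ⁺++⁺_) qs) (ps · qs) xs ⟩
    evalPolynomial (map (s ⁺++⁺_) qs) xs + evalPolynomial (ps · qs) xs
      ≈⟨ +-cong (evalPolynomial-map-⁺++⁺ s qs xs) (evalPolynomial-· ps qs xs) ⟩
    evalMonomial s xs * evalPolynomial qs xs + evalPolynomial ps xs * evalPolynomial qs xs
      ≈⟨ distribʳ _ _ _ ⟨
    (evalMonomial s xs + evalPolynomial ps xs) * evalPolynomial qs xs ∎

  induced-* : ∀ {f g} → Induced f → Induced g → Induced (λ xs → f xs * g xs)
  induced-* (p , p≈f) (q , q≈g) =
    p · q , λ xs → trans (evalPolynomial-· p q xs) (*-cong (p≈f xs) (q≈g xs))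

  induced-sum : ∀ {n} (h : Fin n → Vector Carrier k → Carrier) → (∀ l → Induced (h l)) →
                Induced (λ xs → sum (λ l → h l xs))
  induced-sum {zero}  h h-induced = induced-0#
  induced-sum {suc n} h h-induced =
    induced-+ (h-induced fzero) (induced-sum (h ∘ fsuc) (h-induced ∘ fsuc))

  -1#-isUnit : IsUnit (- 1#)
  -1#-isUnit = - 1# , -1*-1≈1 , -1*-1≈1
    where
    -1*-1≈1 : - 1# * - 1# ≈ 1#
    -1*-1≈1 = trans (-1*x≈-x (- 1#)) (-‿involutive 1#)

  square-zero⇒1+x-isUnit : ∀ {x} → x * x ≈ 0# → IsUnit (1# + x)
  square-zero⇒1+x-isUnit {x} x²≈0 = 1# - x , right-inverse , left-inverse
    where
    right-inverse : (1# + x) * (1# - x) ≈ 1#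
    right-inverse = begin
      (1# + x) * (1# - x)           ≈⟨ x[y-z]≈xy-xz (1# + x) 1# x ⟩
      (1# + x) * 1# - (1# + x) * x  ≈⟨ +-cong (*-identityʳ _) (-‿cong (distribʳ x 1# x)) ⟩
      (1# + x) - (1# * x + x * x)   ≈⟨ +-congˡ (-‿cong (+-cong (*-identityˡ x) x²≈0)) ⟩
      (1# + x) - (x + 0#)           ≈⟨ +-congˡ (-‿cong (+-identityʳ x)) ⟩
      (1# + x) - x                  ≈⟨ //-rightDividesʳ x 1# ⟩
      1#                            ∎
    left-inverse : (1# - x) * (1# + x) ≈ 1#
    left-inverse = begin
      (1# - x) * (1# + x)           ≈⟨ distribˡ (1# - x) 1# x ⟩
      (1# - x) * 1# + (1# - x) * x  ≈⟨ +-cong (*-identityʳ _) ([y-z]x≈yx-zx x 1# x) ⟩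
      (1# - x) + (1# * x - x * x)   ≈⟨ +-congˡ (+-cong (*-identityˡ x) (-‿cong x²≈0)) ⟩
      (1# - x) + (x - 0#)           ≈⟨ +-congˡ (trans (+-congˡ ε⁻¹≈ε) (+-identityʳ x)) ⟩
      (1# - x) + x                  ≈⟨ //-rightDividesˡ x 1# ⟩
      1#                            ∎

  induced-square-zero : ∀ {x} → x * x ≈ 0# → Induced (λ _ → x)
  induced-square-zero {x} x²≈0 =
    induced-resp (induced-+ (induced-unit (square-zero⇒1+x-isUnit x²≈0))
                            (induced-unit -1#-isUnit))
                 (λ _ → 1+x-1≈x)
    where
    1+x-1≈x : (1# + x) + - 1# ≈ x
    1+x-1≈x = trans (+-congʳ (+-comm 1# x)) (//-rightDividesʳ 1# x)

module FiniteField {c ℓ} (F : Field c ℓ) {q : ℕ} (enumeration : HasOrder F q) where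
  open Field F
  open MatrixRing commutativeRing using (∑)
  open FiniteSums commutativeRing using (∑-single)
  open Bijection enumeration using (to; injective; surjective) renaming (cong to to-cong)
  open Algebra.Properties.Group +-group using (x∙y⁻¹≈ε⇒x≈y)
  open Algebra.Properties.CommutativeMonoid.Sum *-commutativeMonoid using () renaming
    (sum to ∏; sum-cong-≋ to ∏-cong; sum-replicate-zero to ∏-replicate-1#; sum-remove to ∏-remove)
  open import Relation.Binary.Reasoning.Setoid setoid

  element : Fin q → Carrier
  element i = proj₁ (surjective i)

  to-element : ∀ i → to (element i) ≡ i
  to-element i = proj₂ (surjective i) refl

  element-to : ∀ a → element (to a) ≈ a
  element-to a = injective (to-element (to a))

  _≈?_ : Decidable _≈_
  a ≈? b with to a ≟ to b
  ... | yes ta≡tb = yes (injective ta≡tb)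
  ... | no  ta≢tb = no (ta≢tb ∘ to-cong)

  element-injective : ∀ {i j} → element i ≈ element j → i ≡ j
  element-injective {i} {j} eᵢ≈eⱼ =
    ≡.trans (≡.sym (to-element i)) (≡.trans (to-cong eᵢ≈eⱼ) (to-element j))

  ∏-zero : ∀ {n} {g : Fin n → Carrier} j → g j ≈ 0# → ∏ g ≈ 0#
  ∏-zero {suc n} {g} j gⱼ≈0 = trans (∏-remove g) (trans (*-congʳ gⱼ≈0) (zeroˡ _))

  invert : ∀ a → ¬ (a ≈ 0#) → Carrier
  invert a a≉0 = proj₁ (inverse a a≉0)

  *-inverseʳ : ∀ a (a≉0 : ¬ (a ≈ 0#)) → a * invert a a≉0 ≈ 1#
  *-inverseʳ a a≉0 = proj₂ (inverse a a≉0)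

  lagrangeFactor : ∀ i j → Dec (j ≡ i) → Carrier → Carrier
  lagrangeFactor i j (yes _)   t = 1#
  lagrangeFactor i j (no j≢i) t = (t - element j) * invert (element i - element j) eᵢ-eⱼ≉0
    where
    eᵢ-eⱼ≉0 : ¬ (element i - element j ≈ 0#)
    eᵢ-eⱼ≉0 = j≢i ∘ ≡.sym ∘ element-injective ∘ x∙y⁻¹≈ε⇒x≈y _ _

  indicator : Fin q → Carrier → Carrier
  indicator i t = ∏ (λ j → lagrangeFactor i j (j ≟ i) t)

  indicator-same : ∀ i {t} → t ≈ element i → indicator i t ≈ 1#
  indicator-same i {t} t≈eᵢ = trans (∏-cong (λ j → factor≈1 j (j ≟ i))) (∏-replicate-1# q)
    where
    factor≈1 : ∀ j d → lagrangeFactor i j d t ≈ 1#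
    factor≈1 j (yes _)   = refl
    factor≈1 j (no j≢i) = trans (*-congʳ (+-congʳ t≈eᵢ)) (*-inverseʳ _ _)

  indicator-other : ∀ i {t} → ¬ (t ≈ element i) → indicator i t ≈ 0#
  indicator-other i {t} t≉eᵢ = ∏-zero (to t) (factor≈0 (to t ≟ i))
    where
    t-eₜ≈0 : t - element (to t) ≈ 0#
    t-eₜ≈0 = trans (+-congˡ (-‿cong (element-to t))) (-‿inverseʳ t)
    factor≈0 : ∀ d → lagrangeFactor i (to t) d t ≈ 0#
    factor≈0 (yes tₜ≡i) =
      ⊥-elim (t≉eᵢ (trans (sym (element-to t)) (reflexive (≡.cong element tₜ≡i))))
    factor≈0 (no _)     = trans (*-congʳ t-eₜ≈0) (zeroˡ _)

  interpolation : ∀ t (G : Carrier → Carrier) → (∀ {a b} → a ≈ b → G a ≈ G b) →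
                  ∑ q (λ i → indicator i t * G (element i)) ≈ G t
  interpolation t G G-cong = begin
    ∑ q (λ i → indicator i t * G (element i))
      ≈⟨ ∑-single (to t) other-terms≈0 ⟩
    indicator (to t) t * G (element (to t))
      ≈⟨ *-cong (indicator-same (to t) (sym (element-to t))) (G-cong (element-to t)) ⟩
    1# * G t
      ≈⟨ *-identityˡ (G t) ⟩
    G t ∎
    where
    other-terms≈0 : ∀ i → i ≢ to t → indicator i t * G (element i) ≈ 0#
    other-terms≈0 i i≢tₜ = trans (*-congʳ (indicator-other i t≉eᵢ)) (zeroˡ _)
      where
      t≉eᵢ : ¬ (t ≈ element i)
      t≉eᵢ t≈eᵢ = i≢tₜ (≡.sym (≡.trans (to-cong t≈eᵢ) (to-element i)))

  module _ {a p} {A : Set a} (P : (A → Carrier) → Set p)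
           (P-const : ∀ b → P (λ _ → b))
           (P-+ : ∀ {s s′} → P s → P s′ → P (λ x → s x + s′ x))
           (P-* : ∀ {s s′} → P s → P s′ → P (λ x → s x * s′ x)) where

    ∏-closed : ∀ {n} (h : Fin n → A → Carrier) → (∀ j → P (h j)) → P (λ x → ∏ (λ j → h j x))
    ∏-closed {zero}  h P-h = P-const 1#
    ∏-closed {suc n} h P-h = P-* (P-h fzero) (∏-closed (h ∘ fsuc) (P-h ∘ fsuc))

    indicator-closed : ∀ {s} → P s → ∀ i → P (λ x → indicator i (s x))
    indicator-closed {s} P-s i = ∏-closed _ (λ j → factor-closed j (j ≟ i))
      where
      factor-closed : ∀ j d → P (λ x → lagrangeFactor i j d (s x))
      factor-closed j (yes _) = P-const 1#
      factor-closed j (no _)  = P-* (P-+ P-s (P-const _)) (P-const _)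

module MatrixFunctions {c ℓ} (F : Field c ℓ) {q : ℕ} (enumeration : HasOrder F q) (m k : ℕ) where
  open Field F
  open MatrixRing commutativeRing using (∑; matRing)
  open MatrixRingProperties commutativeRing m
  open FiniteSums commutativeRing using (∑-cong)
  open FiniteField F enumeration
  open InducedFunctions matrixRing k
  open import Relation.Binary.Reasoning.Setoid setoid

  scalar-induced : ∀ a → Induced (λ _ → scalar a)
  scalar-induced a with a ≈? 0#
  ... | yes a≈0 = induced-resp induced-0# (λ _ i j → sym (trans (*-congʳ a≈0) (zeroˡ _)))
  ... | no  a≉0 = induced-unit (scalar-isUnit (*-inverseʳ a a≉0))

  offDiagonal-induced : ∀ {a b} → a ≢ b → Induced (λ _ → matrixUnit a b)
  offDiagonal-induced a≢b = induced-square-zero (matrixUnit-square-zero a≢b)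

  matrixUnit-induced : ∀ a b → Induced (λ _ → matrixUnit a b)
  matrixUnit-induced a b with a ≟ b
  ... | no a≢b = offDiagonal-induced a≢b
  ... | yes ≡.refl with all? (_≟ a)
  ...   | yes only-a =
    induced-resp induced-1# (λ _ i j → sym (matrixUnit-only-index only-a i j))
  ...   | no ¬only-a with ¬∀⟶∃¬ m (_≡ a) (_≟ a) ¬only-a
  ...     | b , b≢a =
    induced-resp (induced-* (offDiagonal-induced (b≢a ∘ ≡.sym)) (offDiagonal-induced b≢a))
                 (λ _ → matrixUnit-⊗-matrixUnit a b a)

  constant-induced : ∀ A → Induced (λ _ → A)
  constant-induced A = induced-resp
    (induced-sum _ λ a → induced-sum _ λ b →
      induced-* (scalar-induced (A a b)) (matrixUnit-induced a b))
    (λ _ → matrix-decomposition A)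

  Coordinate : Set
  Coordinate = Fin k × Fin m × Fin m

  _≟ᶜ_ : DecidableEquality Coordinate
  _≟ᶜ_ = ≡-dec _≟_ (≡-dec _≟_ _≟_)

  coordinate : Vector Matrix k → Coordinate → Carrier
  coordinate xs (v , i , j) = xs v i j

  coordinate-induced : ∀ p → Induced (λ xs → scalar (coordinate xs p))
  coordinate-induced (v , a , b) = induced-resp
    (induced-sum _ λ l →
      induced-* (induced-* (matrixUnit-induced l a) (induced-var v)) (matrixUnit-induced b l))
    (λ xs → entry-extraction (xs v) a b)

  indicator-induced : ∀ {s} → Induced (scalar ∘ s) → ∀ i →
                      Induced (λ xs → scalar (indicator i (s xs)))
  indicator-induced = indicator-closed (λ s → Induced (scalar ∘ s)) scalar-induced
    (λ s-induced s′-induced →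
      induced-resp (induced-+ s-induced s′-induced) (λ _ i j → sym (scalar-+ _ _ i j)))
    (λ s-induced s′-induced →
      induced-resp (induced-* s-induced s′-induced) (λ _ i j → sym (scalar-* _ _ i j)))

  update : Coordinate → Carrier → Vector Matrix k → Vector Matrix k
  update p a xs v i j with (v , i , j) ≟ᶜ p
  ... | yes _ = a
  ... | no  _ = xs v i j

  update-cong : ∀ {p a b xs ys} r → a ≈ b → (r ≢ p → coordinate xs r ≈ coordinate ys r) →
                coordinate (update p a xs) r ≈ coordinate (update p b ys) r
  update-cong {p} (v , i , j) a≈b agree with (v , i , j) ≟ᶜ p
  ... | yes _   = a≈b
  ... | no r≢p = agree r≢p

  update-self : ∀ p xs r → coordinate (update p (coordinate xs p) xs) r ≈ coordinate xs r
  update-self (v′ , i′ , j′) xs (v , i , j) with (v , i , j) ≟ᶜ (v′ , i′ , j′)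
  ... | yes ≡.refl = refl
  ... | no  _      = refl

  DependsOnly : List Coordinate → (Vector Matrix k → Matrix) → Set (c ⊔ ℓ)
  DependsOnly ps f = ∀ xs ys → (∀ p → p ∈ ps → coordinate xs p ≈ coordinate ys p) → f xs ≋ f ys

  update-dependsOnly : ∀ {p ps f} → DependsOnly (p ∷ ps) f → ∀ a → DependsOnly ps (f ∘ update p a)
  update-dependsOnly f-dep a xs ys agree = f-dep _ _ λ r r∈p∷ps →
    update-cong r refl (λ r≢p → agree r (Any.tail r≢p r∈p∷ps))

  interpolation-at : ∀ {p ps f} → DependsOnly (p ∷ ps) f → ∀ xs →
    sumᴹ (λ i → scalar (indicator i (coordinate xs p)) ⊗ f (update p (element i) xs)) ≋ f xs
  interpolation-at {p} {ps} {f} f-dep xs u w = begin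
    sumᴹ (λ i → scalar (indicator i t) ⊗ f (update p (element i) xs)) u w
      ≡⟨ sumᴹ-entry (λ i → scalar (indicator i t) ⊗ f (update p (element i) xs)) u w ⟩
    ∑ q (λ i → (scalar (indicator i t) ⊗ f (update p (element i) xs)) u w)
      ≈⟨ ∑-cong q (λ i → scalar-⊗ _ (f (update p (element i) xs)) u w) ⟩
    ∑ q (λ i → indicator i t * f (update p (element i) xs) u w)
      ≈⟨ interpolation t (λ a → f (update p a xs) u w)
                         (λ a≈b → f-dep _ _ (λ r _ → update-cong r a≈b (λ _ → refl)) u w) ⟩
    f (update p t xs) u w
      ≈⟨ f-dep _ _ (λ r _ → update-self p xs r) u w ⟩
    f xs u w ∎
    where
    t : Carrier
    t = coordinate xs p

  dependsOnly-induced : ∀ ps f → DependsOnly ps f → Induced f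
  dependsOnly-induced []       f f-const =
    induced-resp (constant-induced (f (λ _ → 𝟘))) (λ xs → f-const _ xs (λ _ ()))
  dependsOnly-induced (p ∷ ps) f f-dep = induced-resp
    (induced-sum _ λ i →
      induced-* (indicator-induced (coordinate-induced p) i)
                (dependsOnly-induced ps _ (update-dependsOnly f-dep (element i))))
    (interpolation-at f-dep)

  allCoordinates : List Coordinate
  allCoordinates = cartesianProduct (allFin k) (cartesianProduct (allFin m) (allFin m))

  ∈-allCoordinates : ∀ p → p ∈ allCoordinates
  ∈-allCoordinates (v , i , j) =
    ∈-cartesianProduct⁺ (∈-allFin v) (∈-cartesianProduct⁺ (∈-allFin i) (∈-allFin j))

  congruent-induced : ∀ f → RingNotions.Congruent (matRing m) f → Induced f
  congruent-induced f f-cong = dependsOnly-induced allCoordinates f λ xs ys agree →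
    f-cong xs ys (λ v i j → agree (v , i , j) (∈-allCoordinates _))

proposition2p3 : ∀ {c ℓ : Level} (m q : ℕ) → IsPrimePower q →
    (F : Field c ℓ) → HasOrder F q →
    let R = MatrixRing.matRing (Field.commutativeRing F) m in
    (k : ℕ) (f : Vector (RawRing.Carrier R) k → RawRing.Carrier R) →
    RingNotions.Congruent R f →
    Σ (RingNotions.RPolynomial R k) λ p → RingNotions.Induces R p f
proposition2p3 m q _ F enumeration k = MatrixFunctions.congruent-induced F enumeration m k
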